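{- Let $m,n\ge 3$ be integers with $m$ odd and $n\equiv 2\pmod 4$, and suppose $m$ is a smallest odd integer $\ge3$ such that $G_{m,n'}$ has a $3$-dynamic $4$-coloring for some integer $n'\ge3$. Let $f$ be a $3$-dynamic $4$-coloring of $G_{m,n}$. Then every $3$-by-$2$ or $2$-by-$3$ subgrid of $G_{m,n}$ (i.e., every vertex set of the form $\{i,i+1,i+2\}\times\{j,j+1\}$ or $\{i,i+1\}\times\{j,j+1,j+2\}$ contained in $[m]\times[n]$) contains vertices of all four colors under $f$.
   Context: For positive integers $m,n$, the grid $G_{m,n}$ is the graph with vertex set $[m]\times[n]$ (where $[p]=\{1,\dots,p\}$) in which $(i,j)$ and $(i',j')$ are adjacent iff $|i-i'|+|j-j'|=1$. An $r$-dynamic $k$-coloring of a graph $G$ is a proper vertex coloring $f$ with at most $k$ colors such that $|f(N(v))|\ge\min\{r,d(v)\}$ for every vertex $v$, where $N(v)$ is the neighborhood and $d(v)$ the degree of $v$. -}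

module Defs where

open import Data.Nat using (ℕ; zero; suc; _+_; _≤_; _<_; _≟_; ∣_-_∣; _⊓_; _%_)
open import Data.Fin using (Fin; toℕ)
import Data.Fin as F
open import Data.Product using (_×_; _,_; proj₁; proj₂; Σ; ∃)
open import Data.List using (List; filter; length; map; cartesianProduct; allFin)
open import Data.List.Membership.Propositional using (_∈_)
import Data.List.Membership.DecPropositional as DecMem
open import Relation.Binary.PropositionalEquality using (_≡_; _≢_)
open import Relation.Nullary using (¬_; Dec)

-- Vertices of the grid G_{m,n}: [m] × [n], represented 0-indexed as Fin m × Fin n
-- (vertex (i,j) of the paper corresponds to (i-1, j-1)).
Vertex : ℕ → ℕ → Set
Vertex m n = Fin m × Fin n

Adj : ∀ {m n} → Vertex m n → Vertex m n → Set
Adj (i , j) (i' , j') = ∣ toℕ i - toℕ i' ∣ + ∣ toℕ j - toℕ j' ∣ ≡ 1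

Adj? : ∀ {m n} (u v : Vertex m n) → Dec (Adj u v)
Adj? (i , j) (i' , j') = (∣ toℕ i - toℕ i' ∣ + ∣ toℕ j - toℕ j' ∣) ≟ 1

vertices : (m n : ℕ) → List (Vertex m n)
vertices m n = cartesianProduct (allFin m) (allFin n)

N : ∀ {m n} → Vertex m n → List (Vertex m n)
N {m} {n} v = filter (Adj? v) (vertices m n)

deg : ∀ {m n} → Vertex m n → ℕ
deg v = length (N v)

numNbrColours : ∀ {m n k} → (Vertex m n → Fin k) → Vertex m n → ℕ
numNbrColours {k = k} f v = length (filter (λ c → c ∈F? map f (N v)) (allFin k))
  where open DecMem (F._≟_ {k}) renaming (_∈?_ to _∈F?_)

Proper : ∀ {m n k} → (Vertex m n → Fin k) → Set
Proper f = ∀ u v → Adj u v → f u ≢ f v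

IsDynColouring : (r m n k : ℕ) → (Vertex m n → Fin k) → Set
IsDynColouring r m n k f = Proper f × (∀ v → r ⊓ deg v ≤ numNbrColours f v)

HasDynColouring : (r m n k : ℕ) → Set
HasDynColouring r m n k = Σ (Vertex m n → Fin k) (IsDynColouring r m n k)

Odd : ℕ → Set
Odd x = x % 2 ≡ 1

Good : ℕ → Set
Good m = ∃ λ n' → 3 ≤ n' × HasDynColouring 3 m n' 4

SmallestOddGood : ℕ → Set
SmallestOddGood m = Odd m × 3 ≤ m × Good m
  × (∀ m' → Odd m' → 3 ≤ m' → m' < m → ¬ Good m')

InBox : ∀ {m n} → (i j a b : ℕ) → Vertex m n → Set
InBox i j a b (x , y) = (i ≤ toℕ x × toℕ x < i + a) × (j ≤ toℕ y × toℕ y < j + b)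

AllBoxesRainbow : ∀ {m n k} → (a b : ℕ) → (Vertex m n → Fin k) → Set
AllBoxesRainbow {m} {n} {k} a b f =
  ∀ i j → i + a ≤ m → j + b ≤ n → ∀ (c : Fin k) → ∃ λ v → InBox i j a b v × f v ≡ c

-- If a 3-by-2 box missed a colour c, each
-- middle cell has three of its four neighbours inside the box, so c occurs just
-- outside the box on both ends of the middle row.  Each bottom cell then has its
-- outside row-neighbour next to one of those c-vertices, so c occurs directly below
-- both bottom cells; but these two vertices are adjacent.  The 2-by-3 case is the
-- 3-by-2 case for the transposed colouring.

module Submission where

open import Defs
open import Data.Nat using (ℕ; zero; suc; _+_; _≤_; _<_; _≤?_; _<?_; _%_; z≤n; s≤s; ∣_-_∣)
open import Function using (_∘_)
open import Data.Nat.Properties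
  using (≤-trans; ≤-reflexive; <-≤-trans; m≤n⇒m≤1+n; m≤n⇒m⊓n≡m; m≤n+m; +-comm; +-monoˡ-<;
         suc-injective; ∣m-n∣≡0⇒m≡n; ∣n-n∣≡0; ∣-∣-comm)
open import Data.Fin using (Fin; toℕ; fromℕ<)
import Data.Fin as F
open import Data.Fin.Properties using (toℕ-fromℕ<; toℕ<n; toℕ-injective; any?; all?)
open import Data.Product using (_×_; _,_; proj₁; proj₂; ∃-syntax; swap)
open import Data.Sum using (_⊎_; inj₁; inj₂)
open import Data.Empty using (⊥)
open import Data.List using (filter; length; map; allFin)
open import Data.List.Membership.Propositional using (_∈_; _∉_)
open import Data.List.Membership.Propositional.Properties
  using (∈-map⁻; ∈-filter⁻; ∈-filter⁺; ∈-cartesianProduct⁺; ∈-allFin)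
open import Data.List.Relation.Unary.Any using (here; there)
open import Data.List.Relation.Binary.Sublist.Propositional using (⊆-refl)
open import Data.List.Relation.Binary.Sublist.Propositional.Properties using (filter⁺)
open import Data.List.Relation.Binary.Sublist.Heterogeneous.Properties using (length-mono-≤)
open import Relation.Binary.PropositionalEquality
  using (_≡_; _≢_; refl; sym; trans; cong; cong₂; subst; ≢-sym)
open import Relation.Nullary using (¬_; yes; no; contradiction)
open import Relation.Nullary.Decidable using (True; toWitness; from-yes; ¬?; _×-dec_; _→-dec_)
open import Relation.Unary using (Pred; Decidable)
open import Data.List.Membership.DecPropositional (F._≟_ {4}) using (_∈?_)

three-distinct∈⇒3≤length : ∀ {A : Set} {a b c : A} {xs} → a ∈ xs → b ∈ xs → c ∈ xs →
                           a ≢ b → a ≢ c → b ≢ c → 3 ≤ length xs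
three-distinct∈⇒3≤length = three
  where
  one : ∀ {A : Set} {a : A} {xs} → a ∈ xs → 1 ≤ length xs
  one (here _)  = s≤s z≤n
  one (there _) = s≤s z≤n

  two : ∀ {A : Set} {a b : A} {xs} → a ∈ xs → b ∈ xs → a ≢ b → 2 ≤ length xs
  two (here refl) (here refl) a≢b = contradiction refl a≢b
  two (here _)    (there b∈)  _   = s≤s (one b∈)
  two (there a∈)  (here _)    _   = s≤s (one a∈)
  two (there a∈)  (there b∈)  a≢b = m≤n⇒m≤1+n (two a∈ b∈ a≢b)

  three : ∀ {A : Set} {a b c : A} {xs} → a ∈ xs → b ∈ xs → c ∈ xs →
          a ≢ b → a ≢ c → b ≢ c → 3 ≤ length xs
  three (here refl) (here refl) _           a≢b _   _   = contradiction refl a≢b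
  three (here refl) _           (here refl) _   a≢c _   = contradiction refl a≢c
  three _           (here refl) (here refl) _   _   b≢c = contradiction refl b≢c
  three (here _)    (there b∈)  (there c∈)  _   _   b≢c = s≤s (two b∈ c∈ b≢c)
  three (there a∈)  (here _)    (there c∈)  _   a≢c _   = s≤s (two a∈ c∈ a≢c)
  three (there a∈)  (there b∈)  (here _)    a≢b _   _   = s≤s (two a∈ b∈ a≢b)
  three (there a∈)  (there b∈)  (there c∈)  a≢b a≢c b≢c =
    m≤n⇒m≤1+n (three a∈ b∈ c∈ a≢b a≢c b≢c)

avoiding? : (a b : Fin 4) → Decidable (λ x → x ≢ a × x ≢ b)
avoiding? a b x = ¬? (x F.≟ a) ×-dec ¬? (x F.≟ b)

length-filter-avoiding≤2 : ∀ a b → a ≢ b → length (filter (avoiding? a b) (allFin 4)) ≤ 2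
length-filter-avoiding≤2 = from-yes (all? λ a → all? λ b →
  ¬? (a F.≟ b) →-dec (length (filter (avoiding? a b) (allFin 4)) ≤? 2))

length-filter-missing-two≤2 : ∀ {p} {P : Pred (Fin 4) p} (P? : Decidable P) {a b} →
                              a ≢ b → ¬ P a → ¬ P b → length (filter P? (allFin 4)) ≤ 2
length-filter-missing-two≤2 {P = P} P? {a} {b} a≢b ¬Pa ¬Pb =
  ≤-trans (length-mono-≤ (filter⁺ P? (avoiding? a b) avoids (⊆-refl {x = allFin 4})))
          (length-filter-avoiding≤2 a b a≢b)
  where
  avoids : ∀ {x y} → x ≡ y → P x → y ≢ a × y ≢ b
  avoids refl Px = (λ { refl → ¬Pa Px }) , (λ { refl → ¬Pb Px })

SeesAllOtherColours : ∀ {m n} → (Vertex m n → Fin 4) → Set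
SeesAllOtherColours {m} {n} f =
  ∀ (v a b c : Vertex m n) → Adj v a → Adj v b → Adj v c → a ≢ b → a ≢ c → b ≢ c →
  ∀ d → d ≢ f v → ∃[ u ] Adj v u × f u ≡ d

module _ {m n : ℕ} (v : Vertex m n) {u : Vertex m n} where

  adjacent⇒∈N : Adj v u → u ∈ N v
  adjacent⇒∈N = ∈-filter⁺ (Adj? v) (∈-cartesianProduct⁺ (∈-allFin _) (∈-allFin _))

  ∈N⇒adjacent : u ∈ N v → Adj v u
  ∈N⇒adjacent u∈ = proj₂ (∈-filter⁻ (Adj? v) {xs = vertices m n} u∈)

dynamic⇒seesAllOtherColours : ∀ {m n} {f : Vertex m n → Fin 4} →
                              IsDynColouring 3 m n 4 f → SeesAllOtherColours f
dynamic⇒seesAllOtherColours {m} {n} {f} (proper , dynamic) v a b c va vb vc a≢b a≢c b≢c d d≢fv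
  with d ∈? map f (N {m} {n} v)
... | no d∉ = contradiction (≤-trans at-least-three at-most-two) λ { (s≤s (s≤s ())) }
  where
  at-least-three : 3 ≤ numNbrColours f v
  at-least-three = subst (_≤ numNbrColours f v) (m≤n⇒m⊓n≡m deg≥3) (dynamic v)
    where
    deg≥3 : 3 ≤ deg {m} {n} v
    deg≥3 = three-distinct∈⇒3≤length (adjacent⇒∈N v va) (adjacent⇒∈N v vb) (adjacent⇒∈N v vc)
                                     a≢b a≢c b≢c

  own∉ : f v ∉ map f (N {m} {n} v)
  own∉ fv∈ with ∈-map⁻ f fv∈
  ... | u , u∈ , fv≡fu = proper v u (∈N⇒adjacent v u∈) fv≡fu

  at-most-two : numNbrColours f v ≤ 2
  at-most-two = length-filter-missing-two≤2 (_∈? map f (N {m} {n} v)) d≢fv d∉ own∉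
... | yes d∈ with ∈-map⁻ f d∈
...   | u , u∈ , d≡fu = u , ∈N⇒adjacent v u∈ , sym d≡fu

Position : Set
Position = ℕ × ℕ

pos : ∀ {m n} → Vertex m n → Position
pos (i , j) = toℕ i , toℕ j

pos-injective : ∀ {m n} {u w : Vertex m n} → pos u ≡ pos w → u ≡ w
pos-injective {u = i , j} {w = i′ , j′} eq =
  cong₂ _,_ (toℕ-injective (cong proj₁ eq)) (toℕ-injective (cong proj₂ eq))

vertex-at : ∀ {m n r s} → r < m → s < n → ∃[ v ] pos {m} {n} v ≡ (r , s)
vertex-at r<m s<n = (fromℕ< r<m , fromℕ< s<n) , cong₂ _,_ (toℕ-fromℕ< r<m) (toℕ-fromℕ< s<n)

data Dir : Set where
  north south west east : Dir

data Step : Dir → Position → Position → Set where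
  north : ∀ {r s} → Step north (suc r , s) (r , s)
  south : ∀ {r s} → Step south (r , s) (suc r , s)
  west  : ∀ {r s} → Step west (r , suc s) (r , s)
  east  : ∀ {r s} → Step east (r , s) (r , suc s)

step-functional : ∀ {dir p q q′} → Step dir p q → Step dir p q′ → q ≡ q′
step-functional north north = refl
step-functional south south = refl
step-functional west  west  = refl
step-functional east  east  = refl

step-direction-unique : ∀ {dir dir′ p q} → Step dir p q → Step dir′ p q → dir ≡ dir′
step-direction-unique north north = refl
step-direction-unique south south = refl
step-direction-unique west  west  = refl
step-direction-unique east  east  = refl

∣n-1+n∣≡1 : ∀ n → ∣ n - suc n ∣ ≡ 1
∣n-1+n∣≡1 zero    = refl
∣n-1+n∣≡1 (suc n) = ∣n-1+n∣≡1 n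

∣m-n∣≡1⇒n≡1+m⊎m≡1+n : ∀ m n → ∣ m - n ∣ ≡ 1 → n ≡ suc m ⊎ m ≡ suc n
∣m-n∣≡1⇒n≡1+m⊎m≡1+n zero    (suc zero) _ = inj₁ refl
∣m-n∣≡1⇒n≡1+m⊎m≡1+n (suc zero) zero    _ = inj₂ refl
∣m-n∣≡1⇒n≡1+m⊎m≡1+n (suc m) (suc n) eq with ∣m-n∣≡1⇒n≡1+m⊎m≡1+n m n eq
... | inj₁ refl = inj₁ refl
... | inj₂ refl = inj₂ refl

step⇒distance≡1 : ∀ {dir r s r′ s′} → Step dir (r , s) (r′ , s′) → ∣ r - r′ ∣ + ∣ s - s′ ∣ ≡ 1
step⇒distance≡1 (north {r} {s}) = cong₂ _+_ (trans (∣-∣-comm (suc r) r) (∣n-1+n∣≡1 r)) (∣n-n∣≡0 s)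
step⇒distance≡1 (south {r} {s}) = cong₂ _+_ (∣n-1+n∣≡1 r) (∣n-n∣≡0 s)
step⇒distance≡1 (west  {r} {s}) = cong₂ _+_ (∣n-n∣≡0 r) (trans (∣-∣-comm (suc s) s) (∣n-1+n∣≡1 s))
step⇒distance≡1 (east  {r} {s}) = cong₂ _+_ (∣n-n∣≡0 r) (∣n-1+n∣≡1 s)

distance≡1⇒step : ∀ {r s r′ s′} → ∣ r - r′ ∣ + ∣ s - s′ ∣ ≡ 1 → ∃[ dir ] Step dir (r , s) (r′ , s′)
distance≡1⇒step {r} {s} {r′} {s′} eq with ∣ r - r′ ∣ in rows
... | 0 with ∣m-n∣≡0⇒m≡n {r} {r′} rows | ∣m-n∣≡1⇒n≡1+m⊎m≡1+n s s′ eq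
...   | refl | inj₁ refl = east , east
...   | refl | inj₂ refl = west , west
distance≡1⇒step {r} {s} {r′} {s′} eq | 1
  with ∣m-n∣≡1⇒n≡1+m⊎m≡1+n r r′ rows | ∣m-n∣≡0⇒m≡n {s} {s′} (suc-injective eq)
...   | inj₁ refl | refl = south , south
...   | inj₂ refl | refl = north , north
distance≡1⇒step () | suc (suc _)

module _ {m n : ℕ} {u w : Vertex m n} where

  step⇒adjacent : ∀ {dir} → Step dir (pos u) (pos w) → Adj u w
  step⇒adjacent = step⇒distance≡1

  adjacent⇒step : Adj u w → ∃[ dir ] Step dir (pos u) (pos w)
  adjacent⇒step = distance≡1⇒step

module _ {m n : ℕ} (f : Vertex m n → Fin 4) where

  Coloured : Position → Fin 4 → Set
  Coloured p d = ∃[ w ] pos w ≡ p × f w ≡ d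

  NotColoured : Position → Fin 4 → Set
  NotColoured p d = ∃[ w ] pos w ≡ p × f w ≢ d

  NeighbourNotColoured : Dir → Position → Fin 4 → Set
  NeighbourNotColoured dir p d = ∃[ q ] Step dir p q × NotColoured q d

  OtherNeighboursNotColoured : Dir → Position → Fin 4 → Set
  OtherNeighboursNotColoured dir p d = ∀ dir′ → dir′ ≡ dir ⊎ NeighbourNotColoured dir′ p d

  NeighbourColoured : Dir → Position → Fin 4 → Set
  NeighbourColoured dir p d = ∃[ q ] Step dir p q × Coloured q d

  three-neighbours : ∀ {v : Vertex m n} {d} dir → OtherNeighboursNotColoured dir (pos v) d →
                     ∃[ a ] ∃[ b ] ∃[ c ] Adj v a × Adj v b × Adj v c × a ≢ b × a ≢ c × b ≢ c
  three-neighbours {v} {d} = λ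
    { north around → three (other around south λ ()) (other around west λ ()) (other around east λ ())
                           (λ ()) (λ ()) (λ ())
    ; south around → three (other around north λ ()) (other around west λ ()) (other around east λ ())
                           (λ ()) (λ ()) (λ ())
    ; west  around → three (other around north λ ()) (other around south λ ()) (other around east λ ())
                           (λ ()) (λ ()) (λ ())
    ; east  around → three (other around north λ ()) (other around south λ ()) (other around west λ ())
                           (λ ()) (λ ()) (λ ()) }
    where
    Neighbour : Dir → Set
    Neighbour dir = ∃[ w ] Step dir (pos v) (pos w)

    other : ∀ {dir} → OtherNeighboursNotColoured dir (pos v) d → ∀ dir′ → dir′ ≢ dir → Neighbour dir′
    other around dir′ dir′≢dir with around dir′
    ... | inj₁ dir′≡dir                = contradiction dir′≡dir dir′≢dir
    ... | inj₂ (_ , st , w , refl , _) = w , st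

    distinct : ∀ {d₁ d₂} ((w₁ , _) : Neighbour d₁) ((w₂ , _) : Neighbour d₂) → d₁ ≢ d₂ → w₁ ≢ w₂
    distinct (_ , st₁) (_ , st₂) d₁≢d₂ refl = d₁≢d₂ (step-direction-unique st₁ st₂)

    three : ∀ {d₁ d₂ d₃} → Neighbour d₁ → Neighbour d₂ → Neighbour d₃ → d₁ ≢ d₂ → d₁ ≢ d₃ → d₂ ≢ d₃ →
            ∃[ a ] ∃[ b ] ∃[ c ] Adj v a × Adj v b × Adj v c × a ≢ b × a ≢ c × b ≢ c
    three n₁@(a , va) n₂@(b , vb) n₃@(c , vc) d₁≢d₂ d₁≢d₃ d₂≢d₃ =
      a , b , c , step⇒adjacent va , step⇒adjacent vb , step⇒adjacent vc ,
      distinct n₁ n₂ d₁≢d₂ , distinct n₁ n₃ d₁≢d₃ , distinct n₂ n₃ d₂≢d₃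

forced-colour : ∀ {m n} {f : Vertex m n → Fin 4} → SeesAllOtherColours f → ∀ {p d} dir →
                NotColoured f p d → OtherNeighboursNotColoured f dir p d → NeighbourColoured f dir p d
forced-colour {f = f} sees {d = d} dir (v , refl , fv≢d) around
  with three-neighbours f dir around
... | a , b , c , va , vb , vc , a≢b , a≢c , b≢c
  with sees v a b c va vb vc a≢b a≢c b≢c d (≢-sym fv≢d)
... | u , vu , fu≡d
  with adjacent⇒step vu
... | dir′ , st
  with around dir′
... | inj₁ refl = pos u , st , u , refl , fu≡d
... | inj₂ (_ , st′ , w , refl , fw≢d) =
  contradiction (subst (λ x → f x ≡ d) (sym (pos-injective (step-functional st′ st))) fu≡d) fw≢d

module _ {m n : ℕ} {f : Vertex m n → Fin 4} (proper : Proper f) where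

  step-colours-differ : ∀ {dir p q d} → Coloured f p d → Coloured f q d → Step dir p q → ⊥
  step-colours-differ (u , refl , fu≡d) (w , refl , fw≡d) st =
    proper u w (step⇒adjacent st) (trans fu≡d (sym fw≡d))

  neighbour-of-coloured : ∀ {dir p q d} → Coloured f p d → Step dir p q →
                          proj₁ q < m → proj₂ q < n → NotColoured f q d
  neighbour-of-coloured coloured st r<m s<n with vertex-at r<m s<n
  ... | w , pw = w , pw , λ fw≡d → step-colours-differ coloured (w , pw , fw≡d) st

module _ {m n : ℕ} (f : Vertex m n → Fin 4) where

  BoxAvoids : (i j a b : ℕ) → Fin 4 → Set
  BoxAvoids i j a b c = ∀ v → InBox {m} {n} i j a b v → f v ≢ c

  ¬BoxAvoids⇒contains : ∀ {i j a b c} → ¬ BoxAvoids i j a b c →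
                        ∃[ v ] InBox {m} {n} i j a b v × f v ≡ c
  ¬BoxAvoids⇒contains {i} {j} {a} {b} {c} ¬avoids
    with any? (λ x → any? (λ y → inBox? (x , y) ×-dec f (x , y) F.≟ c))
    where
    inBox? : Decidable (InBox {m} {n} i j a b)
    inBox? (x , y) = ((i ≤? toℕ x) ×-dec (toℕ x <? i + a)) ×-dec ((j ≤? toℕ y) ×-dec (toℕ y <? j + b))
  ... | yes (x , y , v∈ , fv≡c) = (x , y) , v∈ , fv≡c
  ... | no ∄v = contradiction (λ (x , y) v∈ fv≡c → ∄v (x , y , v∈ , fv≡c)) ¬avoids

offset-in-range : ∀ {i k a r} → r ≡ k + i → k < a → i ≤ r × r < i + a
offset-in-range {i} {k} {a} refl k<a = m≤n+m i k , <-≤-trans (+-monoˡ-< i k<a) (≤-reflexive (+-comm a i))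

offset<bound : ∀ {i k a b} → k < a → i + a ≤ b → k + i < b
offset<bound k<a i+a≤b = <-≤-trans (proj₂ (offset-in-range refl k<a)) i+a≤b

module _ {m n : ℕ} {f : Vertex m n → Fin 4} (proper : Proper f) (sees : SeesAllOtherColours f)
         {i : ℕ} {c : Fin 4} (hi : i + 3 ≤ m) where

  row<m : ∀ k {k<3 : True (k <? 3)} → k + i < m
  row<m k {k<3} = offset<bound (toWitness k<3) hi

  column<n : ∀ {p d} → Coloured f p d → proj₂ p < n
  column<n ((_ , y) , refl , _) = toℕ<n y

  module Avoiding {j} (hj : j + 2 ≤ n) (avoid : BoxAvoids f i j 3 2 c) where

    cell : ∀ k l {k<3 : True (k <? 3)} {l<2 : True (l <? 2)} → NotColoured f (k + i , l + j) c
    cell k l {k<3} {l<2} with vertex-at (offset<bound (toWitness k<3) hi) (offset<bound (toWitness l<2) hj)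
    ... | v , pv = v , pv , avoid v (offset-in-range (cong proj₁ pv) (toWitness k<3) ,
                                     offset-in-range (cong proj₂ pv) (toWitness l<2))

    flanking-colours : NeighbourColoured f west (suc i , j) c × NeighbourColoured f east (suc i , suc j) c
    flanking-colours =
      forced-colour sees west (cell 1 0) (λ
        { north → inj₂ (_ , north , cell 0 0)
        ; south → inj₂ (_ , south , cell 2 0)
        ; east  → inj₂ (_ , east  , cell 1 1)
        ; west  → inj₁ refl }) ,
      forced-colour sees east (cell 1 1) (λ
        { north → inj₂ (_ , north , cell 0 1)
        ; south → inj₂ (_ , south , cell 2 1)
        ; west  → inj₂ (_ , west  , cell 1 0)
        ; east  → inj₁ refl })

  flanked-box-impossible : ∀ {j} → suc j + 2 ≤ n → BoxAvoids f i (suc j) 3 2 c →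
                           Coloured f (suc i , j) c → Coloured f (suc i , 3 + j) c → ⊥
  flanked-box-impossible hj avoid left right
    with forced-colour sees south (cell 2 0) (λ
           { north → inj₂ (_ , north , cell 1 0)
           ; west  → inj₂ (_ , west  , neighbour-of-coloured proper left south (row<m 2) (column<n left))
           ; east  → inj₂ (_ , east  , cell 2 1)
           ; south → inj₁ refl })
       | forced-colour sees south (cell 2 1) (λ
           { north → inj₂ (_ , north , cell 1 1)
           ; west  → inj₂ (_ , west  , cell 2 0)
           ; east  → inj₂ (_ , east  , neighbour-of-coloured proper right south (row<m 2) (column<n right))
           ; south → inj₁ refl })
    where open Avoiding hj avoid using (cell)
  ... | _ , south , below₀ | _ , south , below₁ = step-colours-differ proper below₀ below₁ east

  3×2-box-cannot-avoid : ∀ {j} → j + 2 ≤ n → ¬ BoxAvoids f i j 3 2 c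
  3×2-box-cannot-avoid hj avoid with Avoiding.flanking-colours hj avoid
  ... | (_ , west , left) , (_ , east , right) = flanked-box-impossible hj avoid left right

3×2-boxes-rainbow : ∀ {m n} {f : Vertex m n → Fin 4} → Proper f → SeesAllOtherColours f →
                    AllBoxesRainbow 3 2 f
3×2-boxes-rainbow {f = f} proper sees i j hi hj c =
  ¬BoxAvoids⇒contains f (3×2-box-cannot-avoid proper sees hi hj)

transpose-adjacent : ∀ {m n} (u w : Vertex m n) → Adj u w → Adj (swap u) (swap w)
transpose-adjacent (i , j) (i′ , j′) = trans (+-comm ∣ toℕ j - toℕ j′ ∣ ∣ toℕ i - toℕ i′ ∣)

module _ {m n : ℕ} {f : Vertex m n → Fin 4} where

  transpose-proper : Proper f → Proper (f ∘ swap)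
  transpose-proper proper u w = proper (swap u) (swap w) ∘ transpose-adjacent u w

  transpose-sees : SeesAllOtherColours f → SeesAllOtherColours (f ∘ swap)
  transpose-sees sees v a b c va vb vc a≢b a≢c b≢c d d≢fv
    with sees (swap v) (swap a) (swap b) (swap c)
              (transpose-adjacent v a va) (transpose-adjacent v b vb) (transpose-adjacent v c vc)
              (a≢b ∘ cong swap) (a≢c ∘ cong swap) (b≢c ∘ cong swap) d d≢fv
  ... | u , vu , fu≡d = swap u , transpose-adjacent (swap v) u vu , fu≡d

  2×3-boxes-rainbow : Proper f → SeesAllOtherColours f → AllBoxesRainbow 2 3 f
  2×3-boxes-rainbow proper sees i j hi hj c
    with 3×2-boxes-rainbow (transpose-proper proper) (transpose-sees sees) j i hj hi c
  ... | v , v∈ , fv≡c = swap v , swap v∈ , fv≡c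

lemma2p3 : (m n : ℕ) → 3 ≤ m → 3 ≤ n → Odd m → n % 4 ≡ 2
    → SmallestOddGood m
    → (f : Vertex m n → Fin 4) → IsDynColouring 3 m n 4 f
    → AllBoxesRainbow 3 2 f × AllBoxesRainbow 2 3 f
lemma2p3 m n _ _ _ _ _ f dynamic@(proper , _) =
  3×2-boxes-rainbow proper sees , 2×3-boxes-rainbow proper sees
  where
  sees : SeesAllOtherColours f
  sees = dynamic⇒seesAllOtherColours dynamic
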